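{- Let $n\ge 1$ and $x\in S_{2n}$. Then: (1) $2|D(x)|=|DS(x)|$; (2) for every $y\in B_nxB_n$ we have $2|D(x)|=|DS(x)|=|DS(y)|=2|D(y)|$; (3) there exists $y\in B_nxB_n$ such that $D(x)=D(y)$ and $S(y)=DS(y)$.
   Context: $S_{2n}$ is the symmetric group on $[2n]=\{1,\dots,2n\}$. For $i\ge 1$ the couple $D_i$ is $\{2i-1,2i\}$, and $\mathbb{D}=\{D_i: i\ge1\}$. The partner map $t$ is given by $t(2i-1)=2i$, $t(2i)=2i-1$. $B_n$ (the hyperoctahedral group) is the centralizer in $S_{2n}$ of $t_n=(1\,2)(3\,4)\cdots(2n-1\,2n)$; equivalently, the set of $x\in S_{2n}$ mapping every couple $D_i$, $i\le n$, onto a couple. For a permutation $x$, $S(x)=\{i: x(i)\neq i\}$ is its support, $D(x)=\{D_i\in\mathbb{D}: x(D_i)\notin\mathbb{D}\}$ (couples not mapped onto couples) is its $\mathbb{D}$-support, and $DS(x)=\bigcup_{D_i\in D(x)}D_i$ is its unpaired $\mathbb{D}$-support. -}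

module Defs where

open import Data.Nat using (ℕ; _*_)
open import Data.Bool using (if_then_else_)
open import Data.Fin using (Fin; zero; suc; combine; remQuot; _≟_)
open import Data.Fin.Subset using (Subset; inside; outside)
open import Data.Fin.Permutation using (Permutation′; _⟨$⟩ʳ_)
open import Data.Vec using (tabulate; lookup)
open import Data.Product using (Σ; _×_; _,_; proj₁)
open import Relation.Binary.PropositionalEquality using (_≡_)
open import Relation.Nullary using (does)

-- Conventions (0-based): the ground set [2n] is Fin (n * 2).
-- The couple D_i (i : Fin n) is { elt i 0 , elt i 1 }, where
-- elt i j = combine i j = 2i + j.  So 1-based couple D_{i+1} = {2i+1, 2i+2}.

elt : ∀ {n} → Fin n → Fin 2 → Fin (n * 2)
elt i j = combine i j

coupleOf : ∀ {n} → Fin (n * 2) → Fin n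
coupleOf {n} k = proj₁ (remQuot {n} 2 k)

flip2 : Fin 2 → Fin 2
flip2 zero = suc zero
flip2 (suc _) = zero

-- the partner map t (t_n as a function on [2n])
partner : ∀ {n} → Fin (n * 2) → Fin (n * 2)
partner {n} k with remQuot {n} 2 k
... | i , j = combine i (flip2 j)

Perm : ℕ → Set
Perm n = Permutation′ (n * 2)

-- B_n: centralizer of t_n in S_{2n}, i.e. x ∘ t_n = t_n ∘ x
InB : ∀ {n} → Perm n → Set
InB {n} b = ∀ k → b ⟨$⟩ʳ (partner {n} k) ≡ partner {n} (b ⟨$⟩ʳ k)

InDoubleCoset : ∀ {n} → Perm n → Perm n → Set
InDoubleCoset {n} y x =
  Σ (Perm n) λ b₁ → Σ (Perm n) λ b₂ →
    InB {n} b₁ × InB {n} b₂ × (∀ k → y ⟨$⟩ʳ k ≡ b₁ ⟨$⟩ʳ (x ⟨$⟩ʳ (b₂ ⟨$⟩ʳ k)))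

S : ∀ {n} → Perm n → Subset (n * 2)
S x = tabulate λ k → if does (x ⟨$⟩ʳ k ≟ k) then outside else inside

-- D(x) = couples D_i with x(D_i) not a couple, i.e. x(2i) and x(2i+1) are not partners
D : ∀ {n} → Perm n → Subset n
D {n} x = tabulate λ i →
  if does (partner {n} (x ⟨$⟩ʳ elt {n} i zero) ≟ x ⟨$⟩ʳ elt {n} i (suc zero)) then outside else inside

DS : ∀ {n} → Perm n → Subset (n * 2)
DS {n} x = tabulate λ k → lookup (D x) (coupleOf {n} k)

module Submission where

-- Write t for the partner involution and call a point k *paired* for a
-- permutation x when x (t k) ≡ t (x k).  A couple lies in D(x) exactly when its
-- points are unpaired, so DS(x) is the set of unpaired points (DS-char).
--   (1) DS(x) is the union of the couples of D(x), each of size two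
--       (card-couples).
--   (2) If y = b₁ x b₂ with b₁, b₂ ∈ B_n, then k is paired for y iff b₂ k is
--       paired for x (DS-coset); so DS(y) is the preimage of DS(x) under the
--       permutation b₂ and has the same size (DS-size-coset).
--   (3) Put U = DS(x) and u = x⁻¹ t x.  A permutation y lies in B_n x as soon as
--       y ∘ u = t ∘ y.  The first-return map of x to U (identity off U) has this
--       property (FirstReturn.ret-twist); swapping its fixed points in U with
--       their partners (RemoveFixedPoints) keeps the property and leaves no fixed
--       point in U.  The result y has S(y) = U = DS(y) = DS(x), and D(y) = D(x).

open import Defs
open import Data.Nat using (ℕ; zero; suc; _+_; _∸_; _*_; _≤_; _<_; z≤n; s≤s)
import Data.Nat.Properties as ℕ
open import Data.Bool using (Bool; true; false; if_then_else_; _∧_; _∨_)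
open import Data.Bool.Properties using (∨-comm)
open import Data.Fin using (Fin; zero; suc; combine; remQuot; _≟_; toℕ; punchOut)
import Data.Fin.Properties as Fin
open import Data.Fin.Subset using (Subset; inside; outside; ∣_∣)
open import Data.Fin.Permutation
  using (Permutation′; _⟨$⟩ʳ_; _⟨$⟩ˡ_; inverseˡ; inverseʳ; permutation; id; flip; _∘ₚ_)
open import Data.Vec using (tabulate; lookup; _∷_; [])
import Data.Vec.Properties as Vec
open import Data.Product using (Σ; _×_; _,_; proj₁; proj₂)
open import Data.Sum using (_⊎_; inj₁; inj₂)
open import Data.Empty using (⊥; ⊥-elim)
open import Function.Bundles using (_⇔_; mk⇔)
open import Relation.Nullary using (Dec; yes; no; does)
open import Relation.Nullary.Decidable using (does-⇔; dec-true; dec-false)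
open import Relation.Binary.PropositionalEquality
import Algebra.Properties.CommutativeMonoid.Sum as MonoidSum

true≢false : true ≢ false
true≢false ()

perm-injective : ∀ {m} (π : Permutation′ m) {a b : Fin m} →
                 π ⟨$⟩ʳ a ≡ π ⟨$⟩ʳ b → a ≡ b
perm-injective π eq = trans (sym (inverseˡ π)) (trans (cong (π ⟨$⟩ˡ_) eq) (inverseˡ π))

-- Pigeonhole: an injective endomap of Fin m is surjective.  A missed point j
-- would let f, punched out at j, inject Fin (suc m) into Fin m.
injective⇒surjective : ∀ m (f : Fin m → Fin m) → (∀ {a b} → f a ≡ f b → a ≡ b) →
                       ∀ j → Σ (Fin m) λ i → f i ≡ j
injective⇒surjective m f f-inj j with Fin.any? (λ i → f i ≟ j)
... | yes hit = hit
injective⇒surjective (suc m) f f-inj j | no miss =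
  ⊥-elim (ℕ.<-irrefl refl (Fin.injective⇒≤ {f = punched} punched-inj))
  where
    punched : Fin (suc m) → Fin m
    punched i = punchOut {i = j} {j = f i} (λ eq → miss (i , sym eq))
    punched-inj : ∀ {a b} → punched a ≡ punched b → a ≡ b
    punched-inj {a} {b} eq =
      f-inj (Fin.punchOut-injective (λ e → miss (a , sym e)) (λ e → miss (b , sym e)) eq)

injection⇒permutation : ∀ m (f : Fin m → Fin m) → (∀ {a b} → f a ≡ f b → a ≡ b) →
                        Σ (Permutation′ m) λ π → ∀ k → π ⟨$⟩ʳ k ≡ f k
injection⇒permutation m f f-inj =
  permutation f f⁻¹ (λ j → proj₂ (preimage j)) (λ i → f-inj (proj₂ (preimage (f i)))) ,
  λ k → refl
  where
    preimage : ∀ j → Σ (Fin m) λ i → f i ≡ j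
    preimage = injective⇒surjective m f f-inj
    f⁻¹ : Fin m → Fin m
    f⁻¹ j = proj₁ (preimage j)

open MonoidSum ℕ.+-0-commutativeMonoid using (sum; sum-permute)

indicator : Bool → ℕ
indicator true = 1
indicator false = 0

card-tabulate : ∀ m (g : Fin m → Bool) → ∣ tabulate g ∣ ≡ sum (λ i → indicator (g i))
card-tabulate zero g = refl
card-tabulate (suc m) g with g zero
... | true = cong suc (card-tabulate m (λ i → g (suc i)))
... | false = card-tabulate m (λ i → g (suc i))

card-preimage : ∀ {m} (π : Permutation′ m) (s : Subset m) →
                ∣ tabulate (λ k → lookup s (π ⟨$⟩ʳ k)) ∣ ≡ ∣ s ∣
card-preimage {m} π s = begin
  ∣ tabulate (λ k → lookup s (π ⟨$⟩ʳ k)) ∣     ≡⟨ card-tabulate m _ ⟩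
  sum (λ k → indicator (lookup s (π ⟨$⟩ʳ k)))  ≡⟨ sum-permute (λ i → indicator (lookup s i)) π ⟨
  sum (λ i → indicator (lookup s i))          ≡⟨ card-tabulate m (lookup s) ⟨
  ∣ tabulate (lookup s) ∣                      ≡⟨ cong ∣_∣ (Vec.tabulate∘lookup s) ⟩
  ∣ s ∣                                        ∎
  where open ≡-Reasoning

-- The first-return map of a permutation π to a decidable subset q: a point
-- a ∈ q is sent to the first point of π a, π² a, … lying in q.
module FirstReturn {m : ℕ} (π : Permutation′ m) (q : Fin m → Bool) where

  p : Fin m → Fin m
  p = π ⟨$⟩ʳ_

  iter : ℕ → Fin m → Fin m
  iter zero a = a
  iter (suc k) a = iter k (p a)

  iter-p : ∀ d a → iter d (p a) ≡ p (iter d a)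
  iter-p zero a = refl
  iter-p (suc d) a = iter-p d (p a)

  iter-+ : ∀ i d a → iter (i + d) a ≡ iter i (iter d a)
  iter-+ zero d a = refl
  iter-+ (suc i) d a = trans (iter-+ i d (p a)) (cong (iter i) (iter-p d a))

  iter-injective : ∀ k {a b} → iter k a ≡ iter k b → a ≡ b
  iter-injective zero eq = eq
  iter-injective (suc k) eq = perm-injective π (iter-injective k eq)

  -- Every point comes back to itself after between 1 and m steps (pigeonhole
  -- on a, p a, …, pᵐ a).
  returns : ∀ a → Σ ℕ λ k → (1 ≤ k) × (k ≤ m) × (iter k a ≡ a)
  returns a with Fin.pigeonhole (ℕ.n<1+n m) (λ (i : Fin (suc m)) → iter (toℕ i) a)
  ... | i , j , i<j , eq = d , ℕ.m<n⇒0<n∸m i<j , d≤m , sym (iter-injective (toℕ i) eq′)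
    where
      d : ℕ
      d = toℕ j ∸ toℕ i
      d≤m : d ≤ m
      d≤m = ℕ.≤-trans (ℕ.m∸n≤m (toℕ j) (toℕ i)) (ℕ.≤-pred (Fin.toℕ<n j))
      eq′ : iter (toℕ i) a ≡ iter (toℕ i) (iter d a)
      eq′ = trans eq (trans (cong (λ z → iter z a) (sym (ℕ.m+[n∸m]≡n (ℕ.<⇒≤ i<j))))
                            (iter-+ (toℕ i) d a))

  search : ℕ → Fin m → Fin m
  search zero b = b
  search (suc f) b = if q (p b) then p b else search f (p b)

  FirstHit : ℕ → Fin m → Set
  FirstHit f b = Σ ℕ λ j → (1 ≤ j) × (search f b ≡ iter j b) × (q (iter j b) ≡ true)
                   × (∀ i → 1 ≤ i → i < j → q (iter i b) ≡ false)

  search-hit : ∀ f b k → 1 ≤ k → k ≤ f → q (iter k b) ≡ true → FirstHit f b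
  search-hit zero b (suc k) _ () _
  search-hit (suc f) b k 1≤k k≤f qk with q (p b) in qpb
  ... | true = 1 , s≤s z≤n , refl , qpb , λ { (suc zero) _ (s≤s ()) ; (suc (suc i)) _ (s≤s ()) }
  search-hit (suc f) b (suc zero) _ _ qk | false = ⊥-elim (true≢false (trans (sym qk) qpb))
  search-hit (suc f) b (suc (suc k)) _ (s≤s k≤f) qk | false
    with search-hit f (p b) (suc k) (s≤s z≤n) k≤f qk
  ... | j , _ , found , qj , misses = suc j , s≤s z≤n , found , qj , misses′
    where
      misses′ : ∀ i → 1 ≤ i → i < suc j → q (iter i b) ≡ false
      misses′ (suc zero) _ _ = qpb
      misses′ (suc (suc i)) _ (s≤s i<j) = misses (suc i) (s≤s z≤n) i<j

  ret : Fin m → Fin m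
  ret a = search (suc m) a

  -- Points of q do return to q within m steps, since they return to themselves.
  ret-hit : ∀ a → q a ≡ true → FirstHit (suc m) a
  ret-hit a qa with returns a
  ... | k , 1≤k , k≤m , back = search-hit (suc m) a k 1≤k (ℕ.m≤n⇒m≤1+n k≤m) (trans (cong q back) qa)

  -- If pʲ a ≡ pˡ b with 1 ≤ j ≤ l, a ∈ q and no step of b before l lands in q,
  -- then a ≡ b: otherwise a would be such an earlier step of b.
  aligned-hits : ∀ a b j l → j ≤ l → 1 ≤ j → q a ≡ true →
                 (∀ i → 1 ≤ i → i < l → q (iter i b) ≡ false) →
                 iter j a ≡ iter l b → a ≡ b
  aligned-hits a b j l j≤l 1≤j qa misses eq with ℕ.m≤n⇒∃[o]m+o≡n j≤l
  ... | zero , refl = iter-injective j (trans eq (cong (λ z → iter z b) (ℕ.+-identityʳ j)))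
  ... | suc d , refl = ⊥-elim (true≢false (trans (sym qa) (trans (cong q a≡) missed)))
    where
      a≡ : a ≡ iter (suc d) b
      a≡ = iter-injective j (trans eq (iter-+ j (suc d) b))
      missed : q (iter (suc d) b) ≡ false
      missed = misses (suc d) (s≤s z≤n) (ℕ.m<n+m (suc d) 1≤j)

  ret-injective : ∀ {a b} → q a ≡ true → q b ≡ true → ret a ≡ ret b → a ≡ b
  ret-injective {a} {b} qa qb eq with ret-hit a qa | ret-hit b qb
  ... | j , 1≤j , ra , _ , missesa | l , 1≤l , rb , _ , missesb with ℕ.≤-total j l
  ... | inj₁ j≤l = aligned-hits a b j l j≤l 1≤j qa missesb (trans (sym ra) (trans eq rb))
  ... | inj₂ l≤j = sym (aligned-hits b a l j l≤j 1≤l qb missesa (trans (sym rb) (trans (sym eq) ra)))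

  ret-in : ∀ {a} → q a ≡ true → q (ret a) ≡ true
  ret-in {a} qa with ret-hit a qa
  ... | _ , _ , ra , qj , _ = trans (cong q ra) qj

  induced : Fin m → Fin m
  induced a = if q a then ret a else a

  induced-outside : ∀ {a} → q a ≡ false → induced a ≡ a
  induced-outside qa rewrite qa = refl

  induced-inside : ∀ {a} → q a ≡ true → induced a ≡ ret a
  induced-inside qa rewrite qa = refl

  induced-injective : ∀ {a b} → induced a ≡ induced b → a ≡ b
  induced-injective {a} {b} eq with q a in qa | q b in qb
  ... | false | false = eq
  ... | true | true = ret-injective qa qb eq
  ... | true | false = ⊥-elim (true≢false (trans (sym (ret-in qa)) (trans (cong q eq) qb)))
  ... | false | true = ⊥-elim (true≢false (trans (sym (ret-in qb)) (trans (cong q (sym eq)) qa)))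

  module Twist (τ : Fin m → Fin m) (q-τ : ∀ a → q (τ a) ≡ q a)
               (p-τ : ∀ c → q c ≡ false → p (τ c) ≡ τ (p c)) where

    -- Starting outside q, the orbit of τ c is τ of the orbit of c until q is hit.
    search-τ : ∀ f c → q c ≡ false → search f (τ c) ≡ τ (search f c)
    search-τ zero c qc = refl
    search-τ (suc f) c qc rewrite p-τ c qc | q-τ (p c) with q (p c) in qpc
    ... | true = refl
    ... | false = search-τ f (p c) qpc

    ret-twist : ∀ {a b} → p b ≡ τ (p a) → ret b ≡ τ (ret a)
    ret-twist {a} {b} pb rewrite pb | q-τ (p a) with q (p a) in qpa
    ... | true = refl
    ... | false = search-τ m (p a) qpa

-- Composing g with the involution that
-- swaps a flagged point of q (g fixes it or its partner) with its partner
-- yields an injective map without fixed points in q; since the swap commutes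
-- with t, any relation g ∘ u ≡ t ∘ g survives.
module RemoveFixedPoints {m : ℕ} (t : Fin m → Fin m) (t-invol : ∀ k → t (t k) ≡ k)
    (t-≢ : ∀ k → t k ≢ k) (q : Fin m → Bool) (q-t : ∀ k → q (t k) ≡ q k)
    (g : Fin m → Fin m) (g-injective : ∀ {a b} → g a ≡ g b → a ≡ b) where

  flagged : Fin m → Bool
  flagged k = q k ∧ (does (g k ≟ k) ∨ does (g (t k) ≟ t k))

  flagged-t : ∀ k → flagged (t k) ≡ flagged k
  flagged-t k = cong₂ _∧_ (q-t k) (trans
    (cong (λ z → does (g (t k) ≟ t k) ∨ does (g z ≟ z)) (t-invol k))
    (∨-comm (does (g (t k) ≟ t k)) (does (g k ≟ k))))

  flagged-intro : ∀ k → q k ≡ true → g k ≡ k → flagged k ≡ true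
  flagged-intro k qk gk rewrite qk | dec-true (g k ≟ k) gk = refl

  flagged-elim : ∀ k → flagged k ≡ true → (g k ≡ k) ⊎ (g (t k) ≡ t k)
  flagged-elim k fk with q k | g k ≟ k | g (t k) ≟ t k
  ... | true | yes fix | _ = inj₁ fix
  ... | true | no _ | yes fix = inj₂ fix
  ... | true | no _ | no _ = ⊥-elim (true≢false (sym fk))
  ... | false | _ | _ = ⊥-elim (true≢false (sym fk))

  swap : Fin m → Fin m
  swap k = if flagged k then t k else k

  swap-t : ∀ k → swap (t k) ≡ t (swap k)
  swap-t k rewrite flagged-t k with flagged k
  ... | true = refl
  ... | false = refl

  swap-invol : ∀ k → swap (swap k) ≡ k
  swap-invol k with flagged k in fk
  ... | true rewrite flagged-t k | fk = t-invol k
  ... | false rewrite fk = refl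

  derange : Fin m → Fin m
  derange k = swap (g k)

  derange-injective : ∀ {a b} → derange a ≡ derange b → a ≡ b
  derange-injective {a} {b} eq =
    g-injective (trans (sym (swap-invol (g a))) (trans (cong swap eq) (swap-invol (g b))))

  derange-outside : ∀ k → q k ≡ false → g k ≡ k → derange k ≡ k
  derange-outside k qk gk rewrite gk | qk = refl

  -- A fixed point k ∈ q of derange is impossible: either g fixes k, so k and
  -- g k = k are flagged, or g k = t k is flagged and g fixes k or t k.
  derange-inside : ∀ k → q k ≡ true → derange k ≢ k
  derange-inside k qk fix with flagged (g k) in fgk
  ... | false = true≢false (trans (sym (flagged-intro k qk fix)) (trans (cong flagged (sym fix)) fgk))
  ... | true = partner-case (trans (sym (t-invol (g k))) (cong t fix))
    where
      partner-case : g k ≡ t k → ⊥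
      partner-case gk≡tk with flagged-elim k (trans (sym (flagged-t k)) (trans (cong flagged (sym gk≡tk)) fgk))
      ... | inj₁ gk≡k = t-≢ k (trans (sym gk≡tk) gk≡k)
      ... | inj₂ gtk≡tk = t-≢ k (g-injective (trans gtk≡tk (sym gk≡tk)))

card-couples : ∀ n (s : Subset n) → ∣ tabulate (λ k → lookup s (coupleOf {n} k)) ∣ ≡ 2 * ∣ s ∣
card-couples zero [] = refl
card-couples (suc n) (true ∷ s) = trans (cong (2 +_) (card-couples n s)) (sym (ℕ.*-suc 2 ∣ s ∣))
card-couples (suc n) (false ∷ s) = card-couples n s

module Couples (n : ℕ) where

  X : Set
  X = Fin (n * 2)

  t : X → X
  t = partner {n}

  e : Fin n → Fin 2 → X
  e = elt {n}

  decomp : ∀ k → Σ (Fin n) λ i → Σ (Fin 2) λ j → k ≡ e i j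
  decomp k = proj₁ (remQuot {n} 2 k) , proj₂ (remQuot {n} 2 k) , sym (Fin.combine-remQuot {n} 2 k)

  e-injective : ∀ {i i′ j j′} → e i j ≡ e i′ j′ → (i ≡ i′) × (j ≡ j′)
  e-injective {i} {i′} {j} {j′} eq
    with trans (sym (Fin.remQuot-combine {n} {2} i j))
               (trans (cong (remQuot {n} 2) eq) (Fin.remQuot-combine i′ j′))
  ... | refl = refl , refl

  coupleOf-e : ∀ i j → coupleOf {n} (e i j) ≡ i
  coupleOf-e i j = cong proj₁ (Fin.remQuot-combine {n} {2} i j)

  t-e : ∀ i j → t (e i j) ≡ e i (flip2 j)
  t-e i j = cong (λ ij → combine (proj₁ ij) (flip2 (proj₂ ij))) (Fin.remQuot-combine {n} {2} i j)

  flip2-invol : ∀ j → flip2 (flip2 j) ≡ j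
  flip2-invol zero = refl
  flip2-invol (suc zero) = refl

  flip2-≢ : ∀ j → flip2 j ≢ j
  flip2-≢ zero ()
  flip2-≢ (suc zero) ()

  t-invol : ∀ k → t (t k) ≡ k
  t-invol k with decomp k
  ... | i , j , refl = trans (cong t (t-e i j)) (trans (t-e i (flip2 j)) (cong (e i) (flip2-invol j)))

  t-≢ : ∀ k → t k ≢ k
  t-≢ k eq with decomp k
  ... | i , j , refl = flip2-≢ j (proj₂ (e-injective (trans (sym (t-e i j)) eq)))

  t-injective : ∀ {a b} → t a ≡ t b → a ≡ b
  t-injective {a} {b} eq = trans (sym (t-invol a)) (trans (cong t eq) (t-invol b))

  coupleOf-t : ∀ k → coupleOf {n} (t k) ≡ coupleOf {n} k
  coupleOf-t k with decomp k
  ... | i , j , refl = trans (cong coupleOf (t-e i j)) (trans (coupleOf-e i (flip2 j)) (sym (coupleOf-e i j)))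

  Paired : Perm n → X → Set
  Paired x k = x ⟨$⟩ʳ t k ≡ t (x ⟨$⟩ʳ k)

  paired? : (x : Perm n) → ∀ k → Dec (Paired x k)
  paired? x k = x ⟨$⟩ʳ t k ≟ t (x ⟨$⟩ʳ k)

  mark : Bool → Bool
  mark b = if b then outside else inside

  couple⇔paired : (f : X → X) → ∀ i j →
                  (t (f (e i zero)) ≡ f (e i (suc zero))) ⇔ (f (t (e i j)) ≡ t (f (e i j)))
  couple⇔paired f i zero = mk⇔
    (λ eq → trans (cong f (t-e i zero)) (sym eq))
    (λ eq → sym (trans (sym (cong f (t-e i zero))) eq))
  couple⇔paired f i (suc zero) = mk⇔
    (λ eq → trans (cong f (t-e i (suc zero))) (t-injective (trans eq (sym (t-invol _)))))
    (λ eq → trans (cong t (trans (sym (cong f (t-e i (suc zero)))) eq)) (t-invol _))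

  DS-char : (x : Perm n) → ∀ k → lookup (DS {n} x) k ≡ mark (does (paired? x k))
  DS-char x k with decomp k
  ... | i , j , refl = begin
    lookup (DS {n} x) (e i j)                 ≡⟨ Vec.lookup∘tabulate _ (e i j) ⟩
    lookup (D {n} x) (coupleOf {n} (e i j))   ≡⟨ cong (lookup (D {n} x)) (coupleOf-e i j) ⟩
    lookup (D {n} x) i                        ≡⟨ Vec.lookup∘tabulate _ i ⟩
    mark (does (t (f (e i zero)) ≟ f (e i (suc zero))))
      ≡⟨ cong mark (does-⇔ (couple⇔paired f i j) (t (f (e i zero)) ≟ f (e i (suc zero))) (paired? x (e i j))) ⟩
    mark (does (paired? x (e i j)))           ∎
    where
      open ≡-Reasoning
      f : X → X
      f = x ⟨$⟩ʳ_

  paired⇒∉DS : (x : Perm n) → ∀ {k} → Paired x k → lookup (DS {n} x) k ≡ false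
  paired⇒∉DS x {k} pk = trans (DS-char x k) (cong mark (dec-true (paired? x k) pk))

  ∉DS⇒paired : (x : Perm n) → ∀ {k} → lookup (DS {n} x) k ≡ false → Paired x k
  ∉DS⇒paired x {k} k∉ with paired? x k | DS-char x k
  ... | yes pk | _ = pk
  ... | no _ | k∈ = ⊥-elim (true≢false (trans (sym k∈) k∉))

  DS-t : (x : Perm n) → ∀ k → lookup (DS {n} x) (t k) ≡ lookup (DS {n} x) k
  DS-t x k = begin
    lookup (DS {n} x) (t k)                   ≡⟨ Vec.lookup∘tabulate _ (t k) ⟩
    lookup (D {n} x) (coupleOf {n} (t k))     ≡⟨ cong (lookup (D {n} x)) (coupleOf-t k) ⟩
    lookup (D {n} x) (coupleOf {n} k)         ≡⟨ Vec.lookup∘tabulate _ k ⟨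
    lookup (DS {n} x) k                       ∎
    where open ≡-Reasoning

  -- D(x) is determined by DS(x): couple i is in D(x) iff its first point is in DS(x).
  D-from-DS : (x y : Perm n) → (∀ k → lookup (DS {n} x) k ≡ lookup (DS {n} y) k) → D {n} x ≡ D {n} y
  D-from-DS x y same = begin
    D {n} x                      ≡⟨ Vec.tabulate∘lookup (D {n} x) ⟨
    tabulate (lookup (D {n} x))  ≡⟨ Vec.tabulate-cong (λ i → trans (D-via-DS x i) (trans (same (e i zero)) (sym (D-via-DS y i)))) ⟩
    tabulate (lookup (D {n} y))  ≡⟨ Vec.tabulate∘lookup (D {n} y) ⟩
    D {n} y                      ∎
    where
      open ≡-Reasoning
      D-via-DS : (z : Perm n) → ∀ i → lookup (D {n} z) i ≡ lookup (DS {n} z) (e i zero)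
      D-via-DS z i = sym (trans (Vec.lookup∘tabulate _ (e i zero)) (cong (lookup (D {n} z)) (coupleOf-e i zero)))

  DS-coset : (x y b₁ b₂ : Perm n) → InB {n} b₁ → InB {n} b₂ →
             (∀ k → y ⟨$⟩ʳ k ≡ b₁ ⟨$⟩ʳ (x ⟨$⟩ʳ (b₂ ⟨$⟩ʳ k))) →
             ∀ k → lookup (DS {n} y) k ≡ lookup (DS {n} x) (b₂ ⟨$⟩ʳ k)
  DS-coset x y b₁ b₂ b₁∈B b₂∈B y≡ k = begin
    lookup (DS {n} y) k               ≡⟨ DS-char y k ⟩
    mark (does (paired? y k))         ≡⟨ cong mark (does-⇔ (mk⇔ to from) (paired? y k) (paired? x c)) ⟩
    mark (does (paired? x c))         ≡⟨ DS-char x c ⟨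
    lookup (DS {n} x) c               ∎
    where
      open ≡-Reasoning
      c : X
      c = b₂ ⟨$⟩ʳ k
      yt≡ : y ⟨$⟩ʳ t k ≡ b₁ ⟨$⟩ʳ (x ⟨$⟩ʳ t c)
      yt≡ = trans (y≡ (t k)) (cong (λ z → b₁ ⟨$⟩ʳ (x ⟨$⟩ʳ z)) (b₂∈B k))
      ty≡ : t (y ⟨$⟩ʳ k) ≡ b₁ ⟨$⟩ʳ t (x ⟨$⟩ʳ c)
      ty≡ = trans (cong t (y≡ k)) (sym (b₁∈B _))
      to : Paired y k → Paired x c
      to pk = perm-injective b₁ (trans (sym yt≡) (trans pk ty≡))
      from : Paired x c → Paired y k
      from pc = trans yt≡ (trans (cong (b₁ ⟨$⟩ʳ_) pc) (sym ty≡))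

  DS-size-coset : (x y : Perm n) → InDoubleCoset {n} y x → ∣ DS {n} x ∣ ≡ ∣ DS {n} y ∣
  DS-size-coset x y (b₁ , b₂ , b₁∈B , b₂∈B , y≡) = begin
    ∣ DS {n} x ∣                                       ≡⟨ card-preimage b₂ (DS {n} x) ⟨
    ∣ tabulate (λ k → lookup (DS {n} x) (b₂ ⟨$⟩ʳ k)) ∣ ≡⟨ cong ∣_∣ (Vec.tabulate-cong (DS-coset x y b₁ b₂ b₁∈B b₂∈B y≡)) ⟨
    ∣ tabulate (lookup (DS {n} y)) ∣                   ≡⟨ cong ∣_∣ (Vec.tabulate∘lookup (DS {n} y)) ⟩
    ∣ DS {n} y ∣                                       ∎
    where open ≡-Reasoning

module Unpairing (n : ℕ) (x : Perm n) where
  open Couples n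

  U : X → Bool
  U = lookup (DS {n} x)

  -- u = x⁻¹ t x is the involution that a representative y of B_n x must
  -- intertwine with t.
  u : X → X
  u a = x ⟨$⟩ˡ t (x ⟨$⟩ʳ a)

  x-u : ∀ a → x ⟨$⟩ʳ u a ≡ t (x ⟨$⟩ʳ a)
  x-u a = inverseʳ x

  u-invol : ∀ a → u (u a) ≡ a
  u-invol a = trans (cong (x ⟨$⟩ˡ_) (trans (cong t (x-u a)) (t-invol _))) (inverseˡ x)

  paired⇒u≡t : ∀ {a} → Paired x a → u a ≡ t a
  paired⇒u≡t {a} pa = perm-injective x (trans (x-u a) (sym pa))

  u≡t⇒paired : ∀ {a} → u a ≡ t a → Paired x a
  u≡t⇒paired {a} ua = trans (cong (x ⟨$⟩ʳ_) (sym ua)) (x-u a)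

  -- u preserves U, since u (u a) ≡ t (u a) iff u a ≡ t a.
  U-u : ∀ a → U (u a) ≡ U a
  U-u a = begin
    U (u a)                        ≡⟨ DS-char x (u a) ⟩
    mark (does (paired? x (u a)))  ≡⟨ cong mark (does-⇔ (mk⇔ to from) (paired? x (u a)) (paired? x a)) ⟩
    mark (does (paired? x a))      ≡⟨ DS-char x a ⟨
    U a                            ∎
    where
      open ≡-Reasoning
      to : Paired x (u a) → Paired x a
      to pua = u≡t⇒paired (sym (trans (cong t (trans (sym (u-invol a)) (paired⇒u≡t pua))) (t-invol (u a))))
      from : Paired x a → Paired x (u a)
      from pa = u≡t⇒paired (trans (u-invol a) (trans (sym (t-invol a)) (cong t (sym (paired⇒u≡t pa)))))

  open FirstReturn x U using (induced; induced-injective; induced-outside; induced-inside)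
  open FirstReturn.Twist x U t (DS-t x) (λ c → ∉DS⇒paired x) using (ret-twist)

  induced-twist : ∀ a → induced (u a) ≡ t (induced a)
  induced-twist a with U a in a∈U
  ... | true = trans (induced-inside (trans (U-u a) a∈U)) (ret-twist (x-u a))
  ... | false = trans (induced-outside (trans (U-u a) a∈U)) (paired⇒u≡t (∉DS⇒paired x a∈U))

  open RemoveFixedPoints t t-invol t-≢ U (DS-t x) induced induced-injective
    using (swap; swap-t; derange; derange-injective; derange-outside; derange-inside)

  derange-twist : ∀ a → derange (u a) ≡ t (derange a)
  derange-twist a = trans (cong swap (induced-twist a)) (swap-t (induced a))

  y : Perm n
  y = proj₁ (injection⇒permutation (n * 2) derange derange-injective)

  -- y x⁻¹ lies in B_n because y intertwines u with t.
  b₁ : Perm n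
  b₁ = flip x ∘ₚ y

  b₁∈B : InB {n} b₁
  b₁∈B k = trans (cong (λ z → derange (x ⟨$⟩ˡ t z)) (sym (inverseʳ x))) (derange-twist (x ⟨$⟩ˡ k))

  y-decomp : ∀ k → y ⟨$⟩ʳ k ≡ b₁ ⟨$⟩ʳ (x ⟨$⟩ʳ (id ⟨$⟩ʳ k))
  y-decomp k = cong derange (sym (inverseˡ x))

  y∈BxB : InDoubleCoset {n} y x
  y∈BxB = b₁ , id , b₁∈B , (λ k → refl) , y-decomp

  DS-y : ∀ k → lookup (DS {n} y) k ≡ U k
  DS-y = DS-coset x y b₁ id b₁∈B (λ k → refl) y-decomp

  D-y : D {n} x ≡ D {n} y
  D-y = D-from-DS x y (λ k → sym (DS-y k))

  S-y : S {n} y ≡ DS {n} y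
  S-y = trans (Vec.tabulate-cong moved) (Vec.tabulate∘lookup (DS {n} y))
    where
      moved-iff : ∀ k b → U k ≡ b → mark (does (y ⟨$⟩ʳ k ≟ k)) ≡ b
      moved-iff k true k∈U = cong mark (dec-false (y ⟨$⟩ʳ k ≟ k) (derange-inside k k∈U))
      moved-iff k false k∉U = cong mark (dec-true (y ⟨$⟩ʳ k ≟ k) (derange-outside k k∉U (induced-outside k∉U)))
      moved : ∀ k → mark (does (y ⟨$⟩ʳ k ≟ k)) ≡ lookup (DS {n} y) k
      moved k = trans (moved-iff k (U k) refl) (sym (DS-y k))

lemma2p5 : (n : _) → 1 ≤ n → (x : Perm n) →
    (2 * ∣ D {n} x ∣ ≡ ∣ DS {n} x ∣)
    × (∀ (y : Perm n) → InDoubleCoset {n} y x →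
         (2 * ∣ D {n} x ∣ ≡ ∣ DS {n} x ∣) × (∣ DS {n} x ∣ ≡ ∣ DS {n} y ∣) × (∣ DS {n} y ∣ ≡ 2 * ∣ D {n} y ∣))
    × Σ (Perm n) (λ y → InDoubleCoset {n} y x × (D {n} x ≡ D {n} y) × (S {n} y ≡ DS {n} y))
lemma2p5 n _ x = part1 x , part2 , (y , y∈BxB , D-y , S-y)
  where
    open Couples n using (DS-size-coset)
    open Unpairing n x using (y; y∈BxB; D-y; S-y)

    part1 : (z : Perm n) → 2 * ∣ D {n} z ∣ ≡ ∣ DS {n} z ∣
    part1 z = sym (card-couples n (D {n} z))

    part2 : ∀ (z : Perm n) → InDoubleCoset {n} z x →
            (2 * ∣ D {n} x ∣ ≡ ∣ DS {n} x ∣) × (∣ DS {n} x ∣ ≡ ∣ DS {n} z ∣) × (∣ DS {n} z ∣ ≡ 2 * ∣ D {n} z ∣)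
    part2 z z∈BxB = part1 x , DS-size-coset x z z∈BxB , sym (part1 z)
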